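{- Let $a$ be a positive integer such that $a+1$ is a prime congruent to $5 \pmod 6$. Then there are no positive integers $b,c$ with $a<b$, $c-b=2$ and $a!\,b!=c!$.
   Context: A solution of $a!\,b!=c!$ in integers with $a<b$ is called a class $k$ solution if $c-b=k$; the claim says there are no class $2$ solutions in positive integers with $a+1$ such a prime. -}

module Defs where

{-# OPTIONS --safe #-}
module Submission where

-- From a! b! = (b + 2)! we get a! = (b + 2)(b + 1), so Wilson's theorem for the prime
-- p = a + 1 gives p ∣ u² + u + 1 with u = b + 1. Then u³ ≡ 1 (mod p), while Fermat's
-- theorem gives u^a ≡ 1. Since p ≡ 5 (mod 6) we have a ≡ 1 (mod 3), hence u ≡ u^a ≡ 1
-- and p ∣ 1 + 1 + 1 = 3, which is impossible for p ≥ 5.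
-- Fermat's theorem comes from x ↦ u x permuting the nonzero residues, Wilson's from
-- pairing each of 2, …, p − 2 with its inverse x^(p−2).

open import Defs
open import Data.Nat using (ℕ; _+_; _*_; _∸_; _<_; _!; _%_; NonZero)
open import Data.Nat.Primality using (Prime)
open import Data.Product using (∃; _×_)
open import Relation.Binary.PropositionalEquality using (_≡_)
open import Relation.Nullary using (¬_)

open import Data.Nat using (zero; suc; _≤_; _^_; z≤n; s≤s; nonTrivial⇒n>1)
open import Data.Nat.Properties
open import Data.Nat.DivMod
open import Data.Nat.Divisibility
open import Data.Nat.Primality using (prime⇒nonTrivial; prime⇒irreducible; euclidsLemma)
open import Data.Nat.Coprimality using (Coprime; coprime-Bézout)
open import Data.Nat.GCD using (module Bézout)
open import Data.Nat.ListAction using (product)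
open import Data.Nat.ListAction.Properties using (product-↭)
open import Data.Nat.Tactic.RingSolver using (solve-∀)
open import Data.List using (List; []; _∷_; _++_; [_]; length; applyDownFrom)
open import Data.List.Membership.Propositional using (_∈_)
open import Data.List.Membership.Propositional.Properties
  using (∈-applyDownFrom⁺; ∈-applyDownFrom⁻; ∈-∃++)
open import Data.List.Membership.Propositional.Properties.WithK using (unique∧set⇒bag)
open import Data.List.Relation.Binary.BagAndSetEquality using (∼bag⇒↭)
open import Data.List.Relation.Binary.Permutation.Propositional using (_↭_; ↭-sym; ↭-prep; ↭⇒↭ₛ)
open import Data.List.Relation.Binary.Permutation.Propositional.Properties
  using (shift; ∈-resp-↭; ↭-length)
open import Data.List.Relation.Unary.Any using (here; there)
open import Data.List.Relation.Unary.All using (_∷_)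
import Data.List.Relation.Unary.All as All
open import Data.List.Relation.Unary.AllPairs using (_∷_)
import Data.List.Relation.Unary.AllPairs as AllPairs
open import Data.List.Relation.Unary.Unique.Propositional using (Unique)
open import Data.List.Relation.Unary.Unique.Propositional.Properties using (applyDownFrom⁺₁)
open import Data.Product using (_,_; proj₁; proj₂)
open import Data.Sum using (_⊎_; inj₁; inj₂; [_,_]′)
open import Function.Base using (_∘_; id)
open import Function.Bundles using (mk⇔)
open import Relation.Binary.PropositionalEquality
  using (refl; sym; trans; cong; cong₂; subst; _≢_; setoid; module ≡-Reasoning)
open import Data.List.Relation.Binary.Permutation.Setoid.Properties (setoid ℕ) using (Unique-resp-↭)
open import Relation.Nullary using (contradiction)
open import Relation.Binary.Bundles using (Setoid)
open import Relation.Binary.Structures using (IsEquivalence)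
import Relation.Binary.Reasoning.Setoid
open import Level using (0ℓ)

product-applyDownFrom-suc : ∀ n → product (applyDownFrom suc n) ≡ n !
product-applyDownFrom-suc zero    = refl
product-applyDownFrom-suc (suc n) = cong (suc n *_) (product-applyDownFrom-suc n)

product-applyDownFrom-2+ : ∀ n → product (applyDownFrom (2 +_) n) ≡ suc n !
product-applyDownFrom-2+ zero    = refl
product-applyDownFrom-2+ (suc n) = cong ((2 + n) *_) (product-applyDownFrom-2+ n)

module Modular (p : ℕ) .{{_ : NonZero p}} where

  -- A record rather than a synonym for m % p ≡ n % p: once p is a concrete suc n, _%_
  -- unfolds and m, n could no longer be inferred from a proof of m ≈ n.
  infix 4 _≈_
  record _≈_ (m n : ℕ) : Set where
    constructor mk
    field %-≡ : m % p ≡ n % p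

  open _≈_ public

  ≈-isEquivalence : IsEquivalence _≈_
  ≈-isEquivalence = record
    { refl  = mk refl
    ; sym   = λ m≈n → mk (sym (%-≡ m≈n))
    ; trans = λ m≈n n≈o → mk (trans (%-≡ m≈n) (%-≡ n≈o))
    }

  ≈-setoid : Setoid 0ℓ 0ℓ
  ≈-setoid = record { isEquivalence = ≈-isEquivalence }

  open IsEquivalence ≈-isEquivalence public
    using () renaming (refl to ≈-refl; reflexive to ≈-reflexive; sym to ≈-sym; trans to ≈-trans)

  module ≈-Reasoning = Relation.Binary.Reasoning.Setoid ≈-setoid

  %-≈ : ∀ m → m % p ≈ m
  %-≈ m = mk (m%n%n≡m%n m p)

  ∣⇒≈0 : ∀ {m} → p ∣ m → m ≈ 0
  ∣⇒≈0 p∣m = mk (%-remove-+ʳ 0 p∣m)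

  ≈0⇒∣ : ∀ {m} → m ≈ 0 → p ∣ m
  ≈0⇒∣ {m} m≈0 = m%n≡0⇒n∣m m p (trans (%-≡ m≈0) (m*n%n≡0 0 p))

  +-cong : ∀ {m n o r} → m ≈ n → o ≈ r → m + o ≈ n + r
  +-cong {m} {n} {o} {r} m≈n o≈r = mk (begin
    (m + o) % p          ≡⟨ %-distribˡ-+ m o p ⟩
    (m % p + o % p) % p  ≡⟨ cong₂ (λ x y → (x + y) % p) (%-≡ m≈n) (%-≡ o≈r) ⟩
    (n % p + r % p) % p  ≡⟨ %-distribˡ-+ n r p ⟨
    (n + r) % p          ∎)
    where open ≡-Reasoning

  *-cong : ∀ {m n o r} → m ≈ n → o ≈ r → m * o ≈ n * r
  *-cong {m} {n} {o} {r} m≈n o≈r = mk (begin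
    (m * o) % p            ≡⟨ %-distribˡ-* m o p ⟩
    (m % p * (o % p)) % p  ≡⟨ cong₂ (λ x y → (x * y) % p) (%-≡ m≈n) (%-≡ o≈r) ⟩
    (n % p * (r % p)) % p  ≡⟨ %-distribˡ-* n r p ⟨
    (n * r) % p            ∎)
    where open ≡-Reasoning

  +-congˡ : ∀ m {n o} → n ≈ o → m + n ≈ m + o
  +-congˡ m = +-cong (≈-refl {m})

  +-congʳ : ∀ o {m n} → m ≈ n → m + o ≈ n + o
  +-congʳ o m≈n = +-cong m≈n (≈-refl {o})

  *-congˡ : ∀ m {n o} → n ≈ o → m * n ≈ m * o
  *-congˡ m = *-cong (≈-refl {m})

  *-congʳ : ∀ o {m n} → m ≈ n → m * o ≈ n * o
  *-congʳ o m≈n = *-cong m≈n (≈-refl {o})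

  ^-cong : ∀ {m n} k → m ≈ n → m ^ k ≈ n ^ k
  ^-cong zero    m≈n = ≈-refl
  ^-cong (suc k) m≈n = *-cong m≈n (^-cong k m≈n)

  ≈∧<⇒≡ : ∀ {m n} → m < p → n < p → m ≈ n → m ≡ n
  ≈∧<⇒≡ m<p n<p m≈n = trans (sym (m<n⇒m%n≡m m<p)) (trans (%-≡ m≈n) (m<n⇒m%n≡m n<p))

  m+n≈n⇒∣m : ∀ m n → m + n ≈ n → p ∣ m
  m+n≈n⇒∣m m n m+n≈n = divides ((m + n) / p ∸ n / p) (begin
    m                                                     ≡⟨ m+n∸n≡m m n ⟨
    (m + n) ∸ n                                           ≡⟨ cong₂ _∸_ (m≡m%n+[m/n]*n (m + n) p) (m≡m%n+[m/n]*n n p) ⟩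
    ((m + n) % p + (m + n) / p * p) ∸ (n % p + n / p * p) ≡⟨ cong (λ r → (r + (m + n) / p * p) ∸ (n % p + n / p * p)) (%-≡ m+n≈n) ⟩
    (n % p + (m + n) / p * p) ∸ (n % p + n / p * p)       ≡⟨ [m+n]∸[m+o]≡n∸o (n % p) _ _ ⟩
    (m + n) / p * p ∸ n / p * p                           ≡⟨ *-distribʳ-∸ p ((m + n) / p) (n / p) ⟨
    ((m + n) / p ∸ n / p) * p                             ∎)
    where open ≡-Reasoning

  inverse-unique : ∀ {m n o} → m * n ≈ 1 → m * o ≈ 1 → n ≈ o
  inverse-unique {m} {n} {o} mn≈1 mo≈1 = begin
    n            ≡⟨ *-identityʳ n ⟨
    n * 1        ≈⟨ *-congˡ n mo≈1 ⟨
    n * (m * o)  ≡⟨ lemma n m o ⟩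
    (m * n) * o  ≈⟨ *-congʳ o mn≈1 ⟩
    1 * o        ≡⟨ *-identityˡ o ⟩
    o            ∎
    where
    open ≈-Reasoning
    lemma : ∀ a b c → a * (b * c) ≡ (b * a) * c
    lemma = solve-∀

  ∣[1+u]*u+1⇒u³≈1 : ∀ u → p ∣ (1 + u) * u + 1 → u ^ 3 ≈ 1
  ∣[1+u]*u+1⇒u³≈1 u p∣N = begin
    u ^ 3                         ≡⟨ +-identityʳ (u ^ 3) ⟨
    u ^ 3 + 0                     ≈⟨ +-congˡ (u ^ 3) (∣⇒≈0 p∣N) ⟨
    u ^ 3 + ((1 + u) * u + 1)     ≡⟨ lemma u ⟩
    1 + u * ((1 + u) * u + 1)     ≈⟨ +-congˡ 1 (*-congˡ u (∣⇒≈0 p∣N)) ⟩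
    1 + u * 0                     ≡⟨ cong suc (*-zeroʳ u) ⟩
    1                             ∎
    where
    open ≈-Reasoning
    lemma : ∀ x → x * (x * (x * 1)) + ((1 + x) * x + 1) ≡ 1 + x * ((1 + x) * x + 1)
    lemma = solve-∀

  u³≈1⇒u^[1+3m]≈u : ∀ u m → u ^ 3 ≈ 1 → u ^ (1 + 3 * m) ≈ u
  u³≈1⇒u^[1+3m]≈u u m u³≈1 = begin
    u ^ (1 + 3 * m)  ≡⟨ cong (u *_) (^-*-assoc u 3 m) ⟨
    u * (u ^ 3) ^ m  ≈⟨ *-congˡ u (^-cong m u³≈1) ⟩
    u * 1 ^ m        ≡⟨ cong (u *_) (^-zeroˡ m) ⟩
    u * 1            ≡⟨ *-identityʳ u ⟩
    u                ∎
    where open ≈-Reasoning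

  product-scaled≈ : ∀ u n → product (applyDownFrom (λ i → u * suc i % p) n) ≈ u ^ n * n !
  product-scaled≈ u zero    = ≈-refl
  product-scaled≈ u (suc n) = begin
    (u * suc n % p) * product (applyDownFrom (λ i → u * suc i % p) n)
      ≈⟨ *-cong (%-≈ (u * suc n)) (product-scaled≈ u n) ⟩
    (u * suc n) * (u ^ n * n !)
      ≡⟨ lemma u n (u ^ n) (n !) ⟩
    u ^ suc n * suc n ! ∎
    where
    open ≈-Reasoning
    lemma : ∀ x k xᵏ k! → (x * suc k) * (xᵏ * k!) ≡ (x * xᵏ) * (k! + k * k!)
    lemma = solve-∀

  module Pairing (σ : ℕ → ℕ) (P : ℕ → Set)
                 (σ-irreflexive : ∀ {x} → P x → σ x ≢ x)
                 (σ-involutive : ∀ {x} → P x → σ (σ x) ≡ x)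
                 (*-σ≈1 : ∀ {x} → P x → x * σ x ≈ 1) where

    Closed : List ℕ → Set
    Closed xs = ∀ {y} → y ∈ xs → σ y ∈ xs

    closed-without-pair : ∀ {x rest} → P x → (∀ {y} → y ∈ rest → P y) →
                          Unique (x ∷ σ x ∷ rest) → Closed (x ∷ σ x ∷ rest) → Closed rest
    closed-without-pair {x} Px P-rest ((_ ∷ x∉rest) ∷ σx∉rest ∷ _) closed {y} y∈rest
      with closed (there (there y∈rest))
    ... | here σy≡x = contradiction (trans (cong σ (sym σy≡x)) (σ-involutive (P-rest y∈rest)))
                                    (All.lookup σx∉rest y∈rest)
    ... | there (here σy≡σx) = contradiction
            (trans (sym (σ-involutive Px)) (trans (cong σ (sym σy≡σx)) (σ-involutive (P-rest y∈rest))))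
            (All.lookup x∉rest y∈rest)
    ... | there (there σy∈rest) = σy∈rest

    -- The bound n drives the recursion, which removes a pair from the middle of the list.
    bounded-product-paired≈1 : ∀ n xs → length xs ≤ n → Unique xs → (∀ {y} → y ∈ xs → P y) →
                       Closed xs → product xs ≈ 1
    bounded-product-paired≈1 _       []         _             _    _  _      = ≈-refl
    bounded-product-paired≈1 (suc n) (x ∷ xs′) (s≤s |xs′|≤n) uniq P-xs closed with closed (here refl)
    ... | here σx≡x = contradiction σx≡x (σ-irreflexive (P-xs (here refl)))
    ... | there σx∈xs′ with ys , zs , refl ← ∈-∃++ σx∈xs′ = begin
      x * product (ys ++ [ σ x ] ++ zs) ≡⟨ cong (x *_) (product-↭ (shift (σ x) ys zs)) ⟩
      x * (σ x * product rest)          ≡⟨ *-assoc x (σ x) (product rest) ⟨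
      (x * σ x) * product rest          ≈⟨ *-cong (*-σ≈1 (P-xs (here refl))) product-rest≈1 ⟩
      1 * 1                             ∎
      where
      open ≈-Reasoning
      rest : List ℕ
      rest = ys ++ zs
      pair-first : x ∷ ys ++ [ σ x ] ++ zs ↭ x ∷ σ x ∷ rest
      pair-first = ↭-prep x (shift (σ x) ys zs)
      P-rest : ∀ {y} → y ∈ rest → P y
      P-rest y∈ = P-xs (∈-resp-↭ (↭-sym pair-first) (there (there y∈)))
      uniq′ : Unique (x ∷ σ x ∷ rest)
      uniq′ = Unique-resp-↭ (↭⇒↭ₛ pair-first) uniq
      closed′ : Closed (x ∷ σ x ∷ rest)
      closed′ y∈ = ∈-resp-↭ pair-first (closed (∈-resp-↭ (↭-sym pair-first) y∈))
      |rest|≤n : length rest ≤ n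
      |rest|≤n = ≤-trans (n≤1+n _) (subst (_≤ n) (↭-length (shift (σ x) ys zs)) |xs′|≤n)
      product-rest≈1 : product rest ≈ 1
      product-rest≈1 = bounded-product-paired≈1 n rest |rest|≤n (AllPairs.tail (AllPairs.tail uniq′))
                         P-rest (closed-without-pair (P-xs (here refl)) P-rest uniq′ closed′)

    product-paired≈1 : ∀ {xs} → Unique xs → (∀ {y} → y ∈ xs → P y) → Closed xs → product xs ≈ 1
    product-paired≈1 {xs} = bounded-product-paired≈1 (length xs) xs ≤-refl

module PrimeModulus (n : ℕ) (p-prime : Prime (suc n)) where

  p : ℕ
  p = suc n

  open Modular p public

  1<p : 1 < p
  1<p = nonTrivial⇒n>1 p {{prime⇒nonTrivial p-prime}}

  ∤1 : p ∤ 1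
  ∤1 p∣1 = <⇒≢ 1<p (sym (∣1⇒≡1 p∣1))

  *≈1⇒∤ʳ : ∀ {u v} → u * v ≈ 1 → p ∤ v
  *≈1⇒∤ʳ {u} uv≈1 p∣v = ∤1 (≈0⇒∣ (≈-trans (≈-sym uv≈1) (∣⇒≈0 (∣n⇒∣m*n u p∣v))))

  ∤* : ∀ {u v} → p ∤ u → p ∤ v → p ∤ u * v
  ∤* {u} {v} p∤u p∤v p∣uv with euclidsLemma u v p-prime p∣uv
  ... | inj₁ p∣u = p∤u p∣u
  ... | inj₂ p∣v = p∤v p∣v

  ∤! : ∀ {k} → k < p → p ∤ k !
  ∤! {zero}  _   = ∤1
  ∤! {suc k} k<p = ∤* (>⇒∤ k<p) (∤! (<-trans (n<1+n k) k<p))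

  ∤⇒coprime : ∀ {u} → p ∤ u → Coprime p u
  ∤⇒coprime p∤u (d∣p , d∣u) with prime⇒irreducible p-prime d∣p
  ... | inj₁ d≡1 = d≡1
  ... | inj₂ refl = contradiction d∣u p∤u

  inverse : ∀ {u} → p ∤ u → ∃ λ v → u * v ≈ 1
  inverse {u} p∤u with coprime-Bézout (∤⇒coprime p∤u)
  ... | Bézout.-+ x y 1+xp≡yu = y , (begin
    u * y      ≡⟨ trans (*-comm u y) (sym 1+xp≡yu) ⟩
    1 + x * p  ≈⟨ mk ([m+kn]%n≡m%n 1 x p) ⟩
    1          ∎)
    where open ≈-Reasoning
  -- Here y is only an inverse of −u, so (p − 1) y = n y is one of u.
  ... | Bézout.+- x y 1+yu≡xp = n * y , (begin
    u * (n * y)              ≈⟨ mk ([m+kn]%n≡m%n (u * (n * y)) x p) ⟨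
    u * (n * y) + x * p      ≡⟨ cong (u * (n * y) +_) 1+yu≡xp ⟨
    u * (n * y) + (1 + y * u) ≡⟨ lemma u n y ⟩
    1 + y * u * p            ≈⟨ mk ([m+kn]%n≡m%n 1 (y * u) p) ⟩
    1                        ∎)
    where
    open ≈-Reasoning
    lemma : ∀ a b c → a * (b * c) + (1 + c * a) ≡ 1 + c * a * suc b
    lemma = solve-∀

  *-cancelʳ-≈ : ∀ {a b c} → p ∤ c → a * c ≈ b * c → a ≈ b
  *-cancelʳ-≈ {a} {b} {c} p∤c ac≈bc with v , cv≈1 ← inverse p∤c = begin
    a            ≡⟨ *-identityʳ a ⟨
    a * 1        ≈⟨ *-congˡ a cv≈1 ⟨
    a * (c * v)  ≡⟨ *-assoc a c v ⟨
    (a * c) * v  ≈⟨ *-congʳ v ac≈bc ⟩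
    (b * c) * v  ≡⟨ *-assoc b c v ⟩
    b * (c * v)  ≈⟨ *-congˡ b cv≈1 ⟩
    b * 1        ≡⟨ *-identityʳ b ⟩
    b            ∎
    where open ≈-Reasoning

  units : List ℕ
  units = applyDownFrom suc n

  ∈-units⁺ : ∀ {k} → 0 < k → k < p → k ∈ units
  ∈-units⁺ {suc k} _ (s≤s k<n) = ∈-applyDownFrom⁺ suc k<n

  ∈-units⇒< : ∀ {k} → k ∈ units → k < p
  ∈-units⇒< k∈units with _ , i<n , refl ← ∈-applyDownFrom⁻ suc k∈units = s≤s i<n

  ∈-units⇒∤ : ∀ {k} → k ∈ units → p ∤ k
  ∈-units⇒∤ k∈units with _ , i<n , refl ← ∈-applyDownFrom⁻ suc k∈units = >⇒∤ (s≤s i<n)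

  ∤⇒%∈units : ∀ {m} → p ∤ m → m % p ∈ units
  ∤⇒%∈units {m} p∤m = ∈-units⁺ (n≢0⇒n>0 (p∤m ∘ m%n≡0⇒n∣m m p)) (m%n<n m p)

  units-unique : Unique units
  units-unique = applyDownFrom⁺₁ suc n (λ j<i _ → <⇒≢ j<i ∘ sym ∘ suc-injective)

  scaled : ℕ → List ℕ
  scaled u = applyDownFrom (λ i → u * suc i % p) n

  scaled-unique : ∀ {u} → p ∤ u → Unique (scaled u)
  scaled-unique {u} p∤u = applyDownFrom⁺₁ _ n λ {i} {j} j<i i<n u[1+i]≡u[1+j] →
    <⇒≢ j<i (sym (suc-injective (≈∧<⇒≡ (s≤s i<n) (s≤s (<-trans j<i i<n))
      (*-cancelʳ-≈ p∤u (begin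
        suc i * u  ≡⟨ *-comm (suc i) u ⟩
        u * suc i  ≈⟨ mk u[1+i]≡u[1+j] ⟩
        u * suc j  ≡⟨ *-comm u (suc j) ⟩
        suc j * u  ∎)))))
    where open ≈-Reasoning

  scaled⊆units : ∀ {u k} → p ∤ u → k ∈ scaled u → k ∈ units
  scaled⊆units {u} p∤u k∈ with i , i<n , refl ← ∈-applyDownFrom⁻ _ k∈ =
    ∤⇒%∈units (∤* p∤u (>⇒∤ (s≤s i<n)))

  units⊆scaled : ∀ {u k} → p ∤ u → k ∈ units → k ∈ scaled u
  units⊆scaled {u} {k} p∤u k∈
    with v , uv≈1 ← inverse p∤u
    with i , i<n , vk%p≡1+i ← ∈-applyDownFrom⁻ suc (∤⇒%∈units (∤* {v} (*≈1⇒∤ʳ {u} uv≈1) (∈-units⇒∤ k∈)))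
    = subst (_∈ scaled u) (≈∧<⇒≡ (m%n<n (u * suc i) p) (∈-units⇒< k∈) u[1+i]≈k) (∈-applyDownFrom⁺ _ i<n)
    where
    open ≈-Reasoning
    u[1+i]≈k : u * suc i % p ≈ k
    u[1+i]≈k = begin
      u * suc i % p    ≈⟨ %-≈ (u * suc i) ⟩
      u * suc i        ≡⟨ cong (u *_) vk%p≡1+i ⟨
      u * (v * k % p)  ≈⟨ *-congˡ u (%-≈ (v * k)) ⟩
      u * (v * k)      ≡⟨ *-assoc u v k ⟨
      (u * v) * k      ≈⟨ *-congʳ k uv≈1 ⟩
      1 * k            ≡⟨ *-identityˡ k ⟩
      k                ∎

  scaled↭units : ∀ {u} → p ∤ u → scaled u ↭ units
  scaled↭units p∤u = ∼bag⇒↭ (unique∧set⇒bag (scaled-unique p∤u) units-unique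
                                           (mk⇔ (scaled⊆units p∤u) (units⊆scaled p∤u)))

  fermat : ∀ {u} → p ∤ u → u ^ n ≈ 1
  fermat {u} p∤u = *-cancelʳ-≈ (∤! (n<1+n n)) (begin
    u ^ n * n !             ≈⟨ product-scaled≈ u n ⟨
    product (scaled u)      ≡⟨ product-↭ (scaled↭units p∤u) ⟩
    product units           ≡⟨ product-applyDownFrom-suc n ⟩
    n !                     ≡⟨ *-identityˡ (n !) ⟨
    1 * n !                 ∎)
    where open ≈-Reasoning

  x²≈1⇒x≡1∨x≡n : ∀ {x} → x < p → x * x ≈ 1 → x ≡ 1 ⊎ x ≡ n
  x²≈1⇒x≡1∨x≡n {zero}  _   0≈1 = contradiction (≈0⇒∣ (≈-sym 0≈1)) ∤1
  x²≈1⇒x≡1∨x≡n {suc w} x<p x²≈1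
    with euclidsLemma w (2 + w) p-prime (m+n≈n⇒∣m (w * (2 + w)) 1 (≈-trans (≈-reflexive (lemma w)) x²≈1))
    where
    lemma : ∀ w → w * (2 + w) + 1 ≡ suc w * suc w
    lemma = solve-∀
  ... | inj₂ p∣2+w = inj₂ (suc-injective (≤-antisym x<p (∣⇒≤ p∣2+w)))
  ... | inj₁ p∣w with w
  ...   | zero   = inj₁ refl
  ...   | suc v  = contradiction p∣w (>⇒∤ (<-trans (n<1+n (suc v)) x<p))

  ∣[1+u]*u+1⇒∣3 : ∀ u m → n ≡ 1 + 3 * m → p ∣ (1 + u) * u + 1 → p ∣ 3
  ∣[1+u]*u+1⇒∣3 u m n≡1+3m p∣N = ≈0⇒∣ (begin
    (1 + 1) * 1 + 1  ≈⟨ +-congʳ 1 (*-cong (+-congˡ 1 u≈1) u≈1) ⟨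
    (1 + u) * u + 1  ≈⟨ ∣⇒≈0 p∣N ⟩
    0                ∎)
    where
    open ≈-Reasoning
    p∤u : p ∤ u
    p∤u p∣u = ∤1 (∣m+n∣m⇒∣n p∣N (∣n⇒∣m*n (1 + u) p∣u))
    u≈1 : u ≈ 1
    u≈1 = begin
      u                ≈⟨ u³≈1⇒u^[1+3m]≈u u m (∣[1+u]*u+1⇒u³≈1 u p∣N) ⟨
      u ^ (1 + 3 * m)  ≡⟨ cong (u ^_) n≡1+3m ⟨
      u ^ n            ≈⟨ fermat p∤u ⟩
      1                ∎

module Wilson (q : ℕ) (p-prime : Prime (3 + q)) where

  open PrimeModulus (2 + q) p-prime

  inv : ℕ → ℕ
  inv x = x ^ (1 + q) % p

  inv<p : ∀ x → inv x < p
  inv<p x = m%n<n (x ^ (1 + q)) p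

  *-inv≈1 : ∀ {x} → p ∤ x → x * inv x ≈ 1
  *-inv≈1 {x} p∤x = ≈-trans (*-congˡ x (%-≈ (x ^ (1 + q)))) (fermat p∤x)

  inv-involutive : ∀ {x} → p ∤ x → x < p → inv (inv x) ≡ x
  inv-involutive {x} p∤x x<p = ≈∧<⇒≡ (inv<p (inv x)) x<p
    (inverse-unique {inv x} (*-inv≈1 (*≈1⇒∤ʳ {x} (*-inv≈1 p∤x)))
                            (≈-trans (≈-reflexive (*-comm (inv x) x)) (*-inv≈1 p∤x)))

  [p-1]²≈1 : (2 + q) * (2 + q) ≈ 1
  [p-1]²≈1 = begin
    (2 + q) * (2 + q)      ≡⟨ lemma q ⟩
    1 + (1 + q) * (3 + q)  ≈⟨ mk ([m+kn]%n≡m%n 1 (1 + q) p) ⟩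
    1                      ∎
    where
    open ≈-Reasoning
    lemma : ∀ q → (2 + q) * (2 + q) ≡ 1 + (1 + q) * (3 + q)
    lemma = solve-∀

  units∖±1 : List ℕ
  units∖±1 = applyDownFrom (2 +_) q

  ∈-units∖±1⁺ : ∀ {x} → 1 < x → x < 2 + q → x ∈ units∖±1
  ∈-units∖±1⁺ (s≤s (s≤s z≤n)) (s≤s (s≤s i<q)) = ∈-applyDownFrom⁺ (2 +_) i<q

  ∈-units∖±1⁻ : ∀ {x} → x ∈ units∖±1 → 1 < x × x < 2 + q
  ∈-units∖±1⁻ x∈ with _ , i<q , refl ← ∈-applyDownFrom⁻ (2 +_) x∈ = s≤s (s≤s z≤n) , s≤s (s≤s i<q)

  ∈-units∖±1⇒< : ∀ {x} → x ∈ units∖±1 → x < p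
  ∈-units∖±1⇒< x∈ = <-trans (proj₂ (∈-units∖±1⁻ x∈)) (n<1+n (2 + q))

  ∈-units∖±1⇒∤ : ∀ {x} → x ∈ units∖±1 → p ∤ x
  ∈-units∖±1⇒∤ x∈ with _ , _ , refl ← ∈-applyDownFrom⁻ (2 +_) x∈ = >⇒∤ (∈-units∖±1⇒< x∈)

  units∖±1-unique : Unique units∖±1
  units∖±1-unique = applyDownFrom⁺₁ (2 +_) q (λ j<i _ → <⇒≢ j<i ∘ sym ∘ suc-injective ∘ suc-injective)

  inv-irreflexive : ∀ {x} → x ∈ units∖±1 → inv x ≢ x
  inv-irreflexive {x} x∈ invx≡x =
    [ <⇒≢ (proj₁ (∈-units∖±1⁻ x∈)) ∘ sym , <⇒≢ (proj₂ (∈-units∖±1⁻ x∈)) ]′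
      (x²≈1⇒x≡1∨x≡n (∈-units∖±1⇒< x∈) (subst (λ y → x * y ≈ 1) invx≡x (*-inv≈1 (∈-units∖±1⇒∤ x∈))))

  inv-∈ : ∀ {x} → x ∈ units∖±1 → inv x ∈ units∖±1
  inv-∈ {x} x∈ = ∈-units∖±1⁺ (≤∧≢⇒< (n≢0⇒n>0 invx≢0) (invx≢1 ∘ sym)) (≤∧≢⇒< (≤-pred (inv<p x)) invx≢2+q)
    where
    x*invx≈1 : x * inv x ≈ 1
    x*invx≈1 = *-inv≈1 (∈-units∖±1⇒∤ x∈)
    invx≢0 : inv x ≢ 0
    invx≢0 invx≡0 = *≈1⇒∤ʳ {x} x*invx≈1 (subst (p ∣_) (sym invx≡0) (p ∣0))
    inv≡self-inverse⇒≡ : ∀ {y} → y < p → y * y ≈ 1 → inv x ≡ y → x ≡ y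
    inv≡self-inverse⇒≡ {y} y<p y²≈1 invx≡y = ≈∧<⇒≡ (∈-units∖±1⇒< x∈) y<p
      (inverse-unique {y} (≈-trans (≈-reflexive (*-comm y x)) (subst (λ z → x * z ≈ 1) invx≡y x*invx≈1)) y²≈1)
    invx≢1 : inv x ≢ 1
    invx≢1 = <⇒≢ (proj₁ (∈-units∖±1⁻ x∈)) ∘ sym ∘ inv≡self-inverse⇒≡ 1<p ≈-refl
    invx≢2+q : inv x ≢ 2 + q
    invx≢2+q = <⇒≢ (proj₂ (∈-units∖±1⁻ x∈)) ∘ inv≡self-inverse⇒≡ (n<1+n (2 + q)) [p-1]²≈1

  product-units∖±1≈1 : product units∖±1 ≈ 1
  product-units∖±1≈1 = product-paired≈1 units∖±1-unique id inv-∈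
    where
    open Pairing inv (_∈ units∖±1) inv-irreflexive
                 (λ x∈ → inv-involutive (∈-units∖±1⇒∤ x∈) (∈-units∖±1⇒< x∈))
                 (*-inv≈1 ∘ ∈-units∖±1⇒∤)

  wilson : p ∣ (2 + q) ! + 1
  wilson = ≈0⇒∣ (begin
    (2 + q) * (1 + q) ! + 1         ≡⟨ cong (λ t → (2 + q) * t + 1) (product-applyDownFrom-2+ q) ⟨
    (2 + q) * product units∖±1 + 1  ≈⟨ +-congʳ 1 (*-congˡ (2 + q) product-units∖±1≈1) ⟩
    (2 + q) * 1 + 1                 ≡⟨ lemma q ⟩
    p                               ≈⟨ ∣⇒≈0 ∣-refl ⟩
    0                               ∎)
    where
    open ≈-Reasoning
    lemma : ∀ q → (2 + q) * 1 + 1 ≡ 3 + q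
    lemma = solve-∀

wilson : ∀ n → Prime (suc n) → suc n ∣ n ! + 1
wilson zero          p-prime = contradiction (nonTrivial⇒n>1 1 {{prime⇒nonTrivial p-prime}}) (<-irrefl refl)
wilson (suc zero)    _       = ∣-refl
wilson (suc (suc q)) p-prime = Wilson.wilson q p-prime

c∸b≡2⇒c≡2+b : ∀ b c → c ∸ b ≡ 2 → c ≡ 2 + b
c∸b≡2⇒c≡2+b b c c∸b≡2 = trans (sym (m∸n+n≡m b≤c)) (cong (_+ b) c∸b≡2)
  where
  b≤c : b ≤ c
  b≤c = <⇒≤ (m∸n≢0⇒n<m λ c∸b≡0 → contradiction (trans (sym c∸b≡2) c∸b≡0) λ ())

a!b!≡c!⇒a!≡[2+b][1+b] : ∀ a b c → c ∸ b ≡ 2 → a ! * b ! ≡ c ! → a ! ≡ (2 + b) * (1 + b)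
a!b!≡c!⇒a!≡[2+b][1+b] a b c c∸b≡2 a!b!≡c! =
  *-cancelʳ-≡ (a !) ((2 + b) * (1 + b)) (b !) {{b !≢0}} (begin
    a ! * b !                  ≡⟨ a!b!≡c! ⟩
    c !                        ≡⟨ cong _! (c∸b≡2⇒c≡2+b b c c∸b≡2) ⟩
    (2 + b) * ((1 + b) * b !)  ≡⟨ *-assoc (2 + b) (1 + b) (b !) ⟨
    (2 + b) * (1 + b) * b !    ∎)
  where open ≡-Reasoning

[n+1]%6≡5⇒n≡4+6k : ∀ n → (n + 1) % 6 ≡ 5 → n ≡ 4 + 6 * ((n + 1) / 6)
[n+1]%6≡5⇒n≡4+6k n [n+1]%6≡5 = suc-injective (begin
  suc n                           ≡⟨ +-comm 1 n ⟩
  n + 1                           ≡⟨ m≡m%n+[m/n]*n (n + 1) 6 ⟩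
  (n + 1) % 6 + (n + 1) / 6 * 6   ≡⟨ cong₂ _+_ [n+1]%6≡5 (*-comm ((n + 1) / 6) 6) ⟩
  5 + 6 * ((n + 1) / 6)           ∎)
  where open ≡-Reasoning

proposition2p2 : (a : ℕ) → 0 < a → Prime (a + 1) → (a + 1) % 6 ≡ 5 →
    ¬ (∃ λ b → ∃ λ c → 0 < b × 0 < c × a < b × c ∸ b ≡ 2 × a ! * b ! ≡ c !)
proposition2p2 a _ [a+1]-prime [a+1]%6≡5 (b , c , _ , _ , _ , c∸b≡2 , a!b!≡c!) =
  contradiction (∣⇒≤ p∣3) (subst (λ m → ¬ suc m ≤ 3) (sym a≡4+6k) λ { (s≤s (s≤s (s≤s ()))) })
  where
  k : ℕ
  k = (a + 1) / 6
  a≡4+6k : a ≡ 4 + 6 * k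
  a≡4+6k = [n+1]%6≡5⇒n≡4+6k a [a+1]%6≡5
  p-prime : Prime (suc a)
  p-prime = subst Prime (+-comm a 1) [a+1]-prime
  p∣[2+b][1+b]+1 : suc a ∣ (2 + b) * (1 + b) + 1
  p∣[2+b][1+b]+1 = subst (λ m → suc a ∣ m + 1) (a!b!≡c!⇒a!≡[2+b][1+b] a b c c∸b≡2 a!b!≡c!) (wilson a p-prime)
  p∣3 : suc a ∣ 3
  p∣3 = PrimeModulus.∣[1+u]*u+1⇒∣3 a p-prime (1 + b) (1 + 2 * k) (trans a≡4+6k (lemma k)) p∣[2+b][1+b]+1
    where
    lemma : ∀ k → 4 + 6 * k ≡ 1 + 3 * (1 + 2 * k)
    lemma = solve-∀
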